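{- Let $\Theta_1,\Theta_2$ be standard s-substitutions such that all parameters occurring in the domains and ranges of $\Theta_1,\Theta_2$ are among $\{n_1,\ldots,n_\gamma\}$, and let $\mathcal D$ be the set of states over $\{n_1,\ldots,n_\gamma\}$. Then for every $p\in\mathcal D$ and every parameter assignment $\sigma\in\mathcal S(p)$ we have $\sigma((\Theta_1\circ\Theta_2)|_p){\downarrow}=\Theta_1[\sigma]\Theta_2[\sigma]$, where $(\Theta_1\circ\Theta_2)|_p=\psi_p(\Theta_1)\psi_p(\Theta_2)$.
   Context: Parameters range over natural numbers; numerals are $\bar0,\bar1=s(\bar0),\bar2,\ldots$; a parameter assignment $\sigma$ maps parameters to numerals and evaluates terms built from $\bar0$, parameters, $s$ and $p$ (predecessor, $p(\bar0)=\bar0$). For $k\ge1$, a $k$-ary variable class $X$ is a set of first-order variables $X(\nu_1,\ldots,\nu_k)$ indexed bijectively by $k$-tuples of numerals (distinct classes disjoint); $X(r_1,\ldots,r_k)$ with numeric terms $r_i$ is a variable expression, $\sigma(X(r_1,\ldots,r_k)){\downarrow}=X(\sigma(r_1){\downarrow},\ldots,\sigma(r_k){\downarrow})$. Schematic individual terms are built from constants, variables, variable expressions, first-order function symbols and primitive-recursively defined schematic term symbols $\hat t(s_1,\ldots,s_i,r_1,\ldots,r_j)$; $\sigma(t){\downarrow}$ is the first-order term obtained by evaluating under $\sigma$ and unfolding definitions. Each variable class $X$ of arity $k$ has a fixed parameter list $(m_1,\ldots,m_k)$; $X(r_1,\ldots,r_k)$ is standard if each $r_i\in\{m_i,\bar0,p(m_i),s(m_i)\}$;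 a standard term has only standard variable expressions. Two variable expressions are parameter-unifiable if some $\sigma$ evaluates them to the same variable. A standard s-substitution is $\Theta=\{A_1\leftarrow t_1,\ldots,A_\alpha\leftarrow t_\alpha\}$ with $A_i$ standard variable expressions, $t_i$ standard terms, $A_i,A_j$ not parameter-unifiable for $i\neq j$; $\Theta[\sigma]=\{\sigma(A_i){\downarrow}\leftarrow\sigma(t_i){\downarrow}\}_i$, a first-order substitution; for any finite set $\Delta=\{B_j\leftarrow u_j\}$ of bindings of variable expressions, $\sigma(\Delta){\downarrow}=\{\sigma(B_j){\downarrow}\leftarrow\sigma(u_j){\downarrow}\}_j$. $\Theta_1[\sigma]\Theta_2[\sigma]$ is ordinary composition of first-order substitutions. A state over a finite parameter set $\mathcal P$ is a conjunction choosing for each $m\in\mathcal P$ one of: $m=\bar0$; $m\neq\bar0\wedge p(m)=\bar0$; $m\neq\bar0\wedge p(m)\neq\bar0$; $\mathcal S(p)$ is the set of assignments satisfying $p$. $\psi_p$ on a standard variable expression $X(r_1,\ldots,r_k)$ with list $(m_1,\ldots,m_k)$: for each $i$, if $p$ contains $m_i=\bar0$, replace $r_i\in\{m_i,p(m_i),\bar0\}$ by $\bar0$ and $s(m_i)$ by $\bar1$; if $p$ contains $m_i\neq\bar0\wedge p(m_i)=\bar0$, replace $p(m_i)$ by $\bar0$, $m_i$ by $\bar1$, $s(m_i)$ by $\bar2$, leave $\bar0$; otherwise leave $r_i$. $\psi_p$ fixes constants and ordinary variables, is homomorphic over function symbols and individual arguments of schematic symbols, and $\psi_p(\Theta)=\{\psi_p(A_i)\leftarrow\psi_p(t_i)\}_i$.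 Syntactic application $u\Delta$ replaces every occurrence in $u$ of a variable expression syntactically identical to some $B_j$ by $u_j$; syntactic composition of binding sets is $\{A_i\leftarrow a_i\}_i\{B_j\leftarrow b_j\}_j=\{A_i\leftarrow a_i\{B_j\leftarrow b_j\}_j\}_i\cup\{B_j\leftarrow b_j : B_j \text{ syntactically distinct from all } A_i\}$. -}

module Defs where

open import Data.Nat using (ℕ; zero; suc; pred)
open import Data.Nat.Properties using () renaming (_≟_ to _≟ℕ_)
open import Data.Fin using (Fin)
open import Data.Bool using (Bool; true; false; if_then_else_)
open import Data.Maybe using (Maybe; just; nothing)
open import Data.Product using (Σ; ∃; _×_; _,_; proj₁; proj₂)
open import Data.List using (List; []; _∷_; _++_; map; filter; concatMap)
open import Data.List.Relation.Unary.All using (All)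
open import Data.List.Relation.Unary.Any using (any?)
open import Data.List.Relation.Unary.AllPairs using (AllPairs)
open import Data.Vec using (Vec; []; _∷_; lookup; toList; zipWith)
                     renaming (map to vmap)
import Data.Vec.Relation.Unary.All as VAll
open import Data.Vec.Relation.Binary.Pointwise.Inductive using (Pointwise)
open import Data.Vec.Properties using (≡-dec)
open import Relation.Binary.PropositionalEquality using (_≡_; _≢_; refl; cong)
open import Relation.Binary.Definitions using (DecidableEquality)
open import Relation.Nullary using (¬_; yes; no; ¬?; does)

-- Numeric terms over parameters.  Parameters are named by natural numbers
-- (parameter n_i is  par i ); numerals are natural numbers.

data NTerm : Set where
  nz  : NTerm
  par : ℕ → NTerm
  ns  : NTerm → NTerm
  np  : NTerm → NTerm

num : ℕ → NTerm
num zero    = nz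
num (suc k) = ns (num k)

Assignment : Set
Assignment = ℕ → ℕ

evalN : Assignment → NTerm → ℕ
evalN σ nz      = zero
evalN σ (par m) = σ m
evalN σ (ns r)  = suc (evalN σ r)
evalN σ (np r)  = pred (evalN σ r)

paramsN : NTerm → List ℕ
paramsN nz      = []
paramsN (par m) = m ∷ []
paramsN (ns r)  = paramsN r
paramsN (np r)  = paramsN r

_≟N_ : DecidableEquality NTerm
nz ≟N nz = yes refl
nz ≟N par _ = no λ ()
nz ≟N ns _ = no λ ()
nz ≟N np _ = no λ ()
par _ ≟N nz = no λ ()
par m ≟N par k with m ≟ℕ k
... | yes refl = yes refl
... | no ¬e = no λ { refl → ¬e refl }
par _ ≟N ns _ = no λ ()
par _ ≟N np _ = no λ ()
ns _ ≟N nz = no λ ()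
ns _ ≟N par _ = no λ ()
ns r ≟N ns q with r ≟N q
... | yes refl = yes refl
... | no ¬e = no λ { refl → ¬e refl }
ns _ ≟N np _ = no λ ()
np _ ≟N nz = no λ ()
np _ ≟N par _ = no λ ()
np _ ≟N ns _ = no λ ()
np r ≟N np q with r ≟N q
... | yes refl = yes refl
... | no ¬e = no λ { refl → ¬e refl }

data FTm (Const Func : Set) (fArity : Func → ℕ) (V : Set) : Set where
  var : V → FTm Const Func fArity V
  con : Const → FTm Const Func fArity V
  fun : (f : Func) → Vec (FTm Const Func fArity V) (fArity f) → FTm Const Func fArity V

record Sig : Set₁ where
  field
    Const    : Set
    Func     : Set
    fArity   : Func → ℕ
    OVar     : Set
    _≟O_     : DecidableEquality OVar
    VClass   : Set
    _≟V_     : DecidableEquality VClass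
    arity    : VClass → ℕ
    arity≥1  : ∀ X → ¬ (arity X ≡ zero)
    parList  : (X : VClass) → Vec ℕ (arity X)
    Sch      : Set
    schI     : Sch → ℕ
    schJ     : Sch → ℕ
    -- The (primitive-recursive) definition of t̂, given by its unfolding:
    -- for numerals ν₁…ν_j, t̂(x₁,…,x_i,ν₁,…,ν_j) unfolds to a first-order
    -- term built from constants and function symbols over the
    -- individual arguments x₁,…,x_i (represented by  Fin (schI h)).
    unfold   : (h : Sch) → Vec ℕ (schJ h) → FTm Const Func fArity (Fin (schI h))

module Syntax (sig : Sig) where
  open Sig sig

  Tm : Set → Set
  Tm = FTm Const Func fArity

  mutual
    _⟪_⟫ : ∀ {V W} → Tm V → (V → Tm W) → Tm W
    var x    ⟪ f ⟫ = f x
    con c    ⟪ f ⟫ = con c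
    fun g ts ⟪ f ⟫ = fun g (substs ts f)

    substs : ∀ {V W n} → Vec (Tm V) n → (V → Tm W) → Vec (Tm W) n
    substs []       f = []
    substs (t ∷ ts) f = (t ⟪ f ⟫) ∷ substs ts f

  data FVar : Set where
    ord : OVar → FVar
    cls : (X : VClass) → Vec ℕ (arity X) → FVar

  _≟F_ : DecidableEquality FVar
  ord x ≟F ord y with x ≟O y
  ... | yes refl = yes refl
  ... | no ¬e = no λ { refl → ¬e refl }
  ord _ ≟F cls _ _ = no λ ()
  cls _ _ ≟F ord _ = no λ ()
  cls X v ≟F cls Y w with X ≟V Y
  ... | no ¬e = no λ { refl → ¬e refl }
  ... | yes refl with ≡-dec _≟ℕ_ v w
  ...   | yes refl = yes refl
  ...   | no ¬e = no λ { refl → ¬e refl }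

  FOTerm : Set
  FOTerm = Tm FVar

  FOSub : Set
  FOSub = List (FVar × FOTerm)

  lookupFO : FOSub → FVar → FOTerm
  lookupFO []            x = var x
  lookupFO ((y , t) ∷ θ) x with does (y ≟F x)
  ... | true  = t
  ... | false = lookupFO θ x

  applyFO : FOSub → FOTerm → FOTerm
  applyFO θ t = t ⟪ lookupFO θ ⟫

  composeFO : FOSub → FOSub → FVar → FOTerm
  composeFO θ₁ θ₂ x = applyFO θ₂ (lookupFO θ₁ x)

  VE : Set
  VE = Σ VClass (λ X → Vec NTerm (arity X))

  _≟VE_ : DecidableEquality VE
  (X , rs) ≟VE (Y , qs) with X ≟V Y
  ... | no ¬e = no λ e → ¬e (cong proj₁ e)
  ... | yes refl with ≡-dec _≟N_ rs qs
  ...   | yes refl = yes refl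
  ...   | no ¬e = no λ { refl → ¬e refl }

  evalVE : Assignment → VE → FVar
  evalVE σ (X , rs) = cls X (vmap (evalN σ) rs)

  paramsVE : VE → List ℕ
  paramsVE (X , rs) = concatMap paramsN (toList rs)

  ParUnif : VE → VE → Set
  ParUnif A B = ∃ λ (σ : Assignment) → evalVE σ A ≡ evalVE σ B

  data StdN (m : ℕ) : NTerm → Set where
    std-par : StdN m (par m)
    std-z   : StdN m nz
    std-p   : StdN m (np (par m))
    std-s   : StdN m (ns (par m))

  StdVE : VE → Set
  StdVE (X , rs) = Pointwise StdN (parList X) rs

  data STerm : Set where
    scon : Const → STerm
    svar : OVar → STerm
    svx  : (X : VClass) → Vec NTerm (arity X) → STerm
    sfun : (f : Func) → Vec STerm (fArity f) → STerm
    ssch : (h : Sch) → Vec STerm (schI h) → Vec NTerm (schJ h) → STerm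

  mutual
    evalT : Assignment → STerm → FOTerm
    evalT σ (scon c)       = con c
    evalT σ (svar x)       = var (ord x)
    evalT σ (svx X rs)     = var (cls X (vmap (evalN σ) rs))
    evalT σ (sfun f ts)    = fun f (evalTs σ ts)
    evalT σ (ssch h ts rs) = unfold h (vmap (evalN σ) rs) ⟪ lookup (evalTs σ ts) ⟫

    evalTs : ∀ {n} → Assignment → Vec STerm n → Vec FOTerm n
    evalTs σ []       = []
    evalTs σ (t ∷ ts) = evalT σ t ∷ evalTs σ ts

  mutual
    paramsT : STerm → List ℕ
    paramsT (scon c)       = []
    paramsT (svar x)       = []
    paramsT (svx X rs)     = concatMap paramsN (toList rs)
    paramsT (sfun f ts)    = paramsTs ts
    paramsT (ssch h ts rs) = paramsTs ts ++ concatMap paramsN (toList rs)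

    paramsTs : ∀ {n} → Vec STerm n → List ℕ
    paramsTs []       = []
    paramsTs (t ∷ ts) = paramsT t ++ paramsTs ts

  data StdT : STerm → Set where
    std-con : ∀ c → StdT (scon c)
    std-var : ∀ x → StdT (svar x)
    std-vx  : ∀ X rs → StdVE (X , rs) → StdT (svx X rs)
    std-fun : ∀ f ts → VAll.All StdT ts → StdT (sfun f ts)
    std-sch : ∀ h ts rs → VAll.All StdT ts → StdT (ssch h ts rs)

  SSub : Set
  SSub = List (VE × STerm)

  IsStdSSub : SSub → Set
  IsStdSSub Θ = All (λ b → StdVE (proj₁ b) × StdT (proj₂ b)) Θ
              × AllPairs (λ a b → ¬ ParUnif (proj₁ a) (proj₁ b)) Θ

  paramsSub : SSub → List ℕ
  paramsSub = concatMap (λ b → paramsVE (proj₁ b) ++ paramsT (proj₂ b))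

  -- σ(Δ)↓   (and Θ[σ] for an s-substitution Θ)
  evalSub : Assignment → SSub → FOSub
  evalSub σ = map (λ b → evalVE σ (proj₁ b) , evalT σ (proj₂ b))

  data Case : Set where
    isZero : Case
    isOne  : Case
    isBig  : Case

  State : Set
  State = List (ℕ × Case)

  IsStateOver : List ℕ → State → Set
  IsStateOver P st = map proj₁ st ≡ P

  SatCase : Assignment → ℕ → Case → Set
  SatCase σ m isZero = evalN σ (par m) ≡ evalN σ nz
  SatCase σ m isOne  = evalN σ (par m) ≢ evalN σ nz × evalN σ (np (par m)) ≡ evalN σ nz
  SatCase σ m isBig  = evalN σ (par m) ≢ evalN σ nz × evalN σ (np (par m)) ≢ evalN σ nz

  Sat : Assignment → State → Set
  Sat σ st = All (λ c → SatCase σ (proj₁ c) (proj₂ c)) st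

  lookupCase : State → ℕ → Maybe Case
  lookupCase []             m = nothing
  lookupCase ((k , c) ∷ st) m with does (k ≟ℕ m)
  ... | true  = just c
  ... | false = lookupCase st m

  psiN : Maybe Case → ℕ → NTerm → NTerm
  psiN (just isZero) m r =
    if does (r ≟N par m) then nz else
    if does (r ≟N np (par m)) then nz else
    if does (r ≟N nz) then nz else
    if does (r ≟N ns (par m)) then num 1 else r
  psiN (just isOne) m r =
    if does (r ≟N np (par m)) then nz else
    if does (r ≟N par m) then num 1 else
    if does (r ≟N ns (par m)) then num 2 else r
  psiN _ m r = r

  psiVE : State → VE → VE
  psiVE st (X , rs) = X , zipWith (λ m r → psiN (lookupCase st m) m r) (parList X) rs

  mutual
    psiT : State → STerm → STerm
    psiT st (scon c)       = scon c
    psiT st (svar x)       = svar x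
    psiT st (svx X rs)     = svx X (proj₂ (psiVE st (X , rs)))
    psiT st (sfun f ts)    = sfun f (psiTs st ts)
    psiT st (ssch h ts rs) = ssch h (psiTs st ts) rs

    psiTs : ∀ {n} → State → Vec STerm n → Vec STerm n
    psiTs st []       = []
    psiTs st (t ∷ ts) = psiT st t ∷ psiTs st ts

  psiSub : State → SSub → SSub
  psiSub st = map (λ b → psiVE st (proj₁ b) , psiT st (proj₂ b))

  lookupVE : SSub → VE → Maybe STerm
  lookupVE []            A = nothing
  lookupVE ((B , u) ∷ Δ) A with does (B ≟VE A)
  ... | true  = just u
  ... | false = lookupVE Δ A

  mutual
    applyS : STerm → SSub → STerm
    applyS (scon c)       Δ = scon c
    applyS (svar x)       Δ = svar x
    applyS (svx X rs)     Δ with lookupVE Δ (X , rs)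
    ... | just u  = u
    ... | nothing = svx X rs
    applyS (sfun f ts)    Δ = sfun f (applySs ts Δ)
    applyS (ssch h ts rs) Δ = ssch h (applySs ts Δ) rs

    applySs : ∀ {n} → Vec STerm n → SSub → Vec STerm n
    applySs []       Δ = []
    applySs (t ∷ ts) Δ = applyS t Δ ∷ applySs ts Δ

  composeS : SSub → SSub → SSub
  composeS Δ₁ Δ₂ =
    map (λ a → proj₁ a , applyS (proj₂ a) Δ₂) Δ₁
    ++ filter (λ b → ¬? (any? (λ a → proj₁ a ≟VE proj₁ b) Δ₁)) Δ₂

  restrict : State → SSub → SSub → SSub
  restrict st Θ₁ Θ₂ = composeS (psiSub st Θ₁) (psiSub st Θ₂)

{-# OPTIONS --safe #-}
module Submission where

-- Under σ ∈ 𝒮(p), ψ_p rewrites each standard argument into one with the same value, so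
-- σ(ψ_p Θ)↓ = Θ[σ]. The arguments it produces are numerals when p fixes the parameter m to 0 or 1,
-- and otherwise lie among 0̄, p(m), m, s(m), whose values are distinct since σ(m) ≥ 2. Hence on the
-- variable expressions of ψ_p(Θ₁) and ψ_p(Θ₂) syntactic identity coincides with equality of values
-- under σ, so the syntactic composition, which looks variables up and discards the shadowed
-- bindings of ψ_p(Θ₂) by syntactic identity, evaluates to the binding list of the first-order
-- composition Θ₁[σ]Θ₂[σ]. Its domain is duplicate-free because the domains of Θ₁ and of Θ₂ are
-- pairwise non-unifiable.

open import Defs
open import Data.Nat using (ℕ; zero; suc; pred; _<_; _≟_)
open import Data.Nat.Properties using (<⇒≢; >⇒≢; <-trans; n<1+n; n≢0⇒n>0; suc-pred; ≤-reflexive)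
open import Data.Nat.Base using (≢-nonZero)
open import Data.Bool using (true; false; if_then_else_)
open import Data.Maybe using (Maybe; just; nothing; maybe)
open import Data.Unit using (⊤)
open import Data.Fin using (Fin)
open import Data.Product using (Σ; _×_; _,_; proj₁; proj₂; map₂)
open import Data.List using (List; []; _∷_; _++_; map; filter; concatMap)
open import Data.List.Properties using (map-++; map-∘; filter-accept; filter-reject)
open import Data.List.Membership.Propositional using (_∈_; _∉_)
open import Data.List.Membership.Propositional.Properties using (∈-filter⁻)
open import Data.List.Relation.Unary.Any using (Any; here; there; any?)
open import Data.List.Relation.Unary.All using (All; []; _∷_)
import Data.List.Relation.Unary.All as All
open import Data.List.Relation.Unary.All.Properties using (++⁻ˡ; ++⁻ʳ)
open import Data.List.Relation.Unary.AllPairs using (AllPairs)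
import Data.List.Relation.Unary.AllPairs as AllPairs
import Data.List.Relation.Unary.AllPairs.Properties as AllPairs
open import Data.List.Relation.Unary.Unique.Propositional using (Unique)
import Data.List.Relation.Unary.Unique.Propositional.Properties as Unique
open import Data.List.Relation.Binary.Disjoint.Propositional using (Disjoint)
open import Data.Vec using (Vec; []; _∷_; lookup; zipWith; toList) renaming (map to vmap)
import Data.Vec.Relation.Unary.All as VAll
open import Data.Vec.Relation.Binary.Pointwise.Inductive using (Pointwise; []; _∷_)
open import Data.Vec.Properties using (∷-injective)
open import Function using (_∘_; id)
open import Relation.Nullary using (¬_; yes; no; does; proof; ¬?; contradiction)
open import Relation.Nullary.Reflects using (ofʸ; ofⁿ)
open import Relation.Unary using (Pred; Decidable)
open import Relation.Binary.PropositionalEquality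
  using (_≡_; _≢_; refl; sym; trans; cong; cong₂; subst; module ≡-Reasoning)

map-filter-local : ∀ {a b p q} {A : Set a} {B : Set b} {P : Pred A p} {Q : Pred B q}
                   (f : A → B) (P? : Decidable P) (Q? : Decidable Q) {xs : List A} →
                   All (λ x → (P x → Q (f x)) × (Q (f x) → P x)) xs →
                   map f (filter P? xs) ≡ filter Q? (map f xs)
map-filter-local f P? Q? [] = refl
map-filter-local f P? Q? {x ∷ xs} ((to , from) ∷ equivs) with P? x
... | yes px = trans (cong (f x ∷_) (map-filter-local f P? Q? equivs))
                     (sym (filter-accept Q? (to px)))
... | no ¬px = trans (map-filter-local f P? Q? equivs)
                     (sym (filter-reject Q? (¬px ∘ from)))

pred≡0⇒≡1 : ∀ {n} → n ≢ 0 → pred n ≡ 0 → n ≡ 1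
pred≡0⇒≡1 {zero}  n≢0 _    = contradiction refl n≢0
pred≡0⇒≡1 {suc n} _   n≡0 = cong suc n≡0

data Numeral : NTerm → Set where
  numeral : ∀ k → Numeral (num k)

evalN-num : ∀ σ k → evalN σ (num k) ≡ k
evalN-num σ zero    = refl
evalN-num σ (suc k) = cong suc (evalN-num σ k)

numeral-evalN-injective : ∀ {σ r q} → Numeral r → Numeral q → evalN σ r ≡ evalN σ q → r ≡ q
numeral-evalN-injective {σ} (numeral k) (numeral l) eq =
  cong num (trans (sym (evalN-num σ k)) (trans eq (evalN-num σ l)))

numeral-if-≟N-refl : ∀ r k {u : NTerm} → Numeral (if does (r ≟N r) then num k else u)
numeral-if-≟N-refl r k with r ≟N r
... | yes _  = numeral k
... | no r≢r = contradiction refl r≢r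

data BigArg (m : ℕ) : NTerm → Set where
  big-0 : BigArg m nz
  big-p : BigArg m (np (par m))
  big-m : BigArg m (par m)
  big-s : BigArg m (ns (par m))

-- As σ m ≥ 2, the four values are ordered 0 < σ m ∸ 1 < σ m < σ m + 1.
bigArg-evalN-injective : ∀ {σ m r q} → σ m ≢ 0 → pred (σ m) ≢ 0 →
                         BigArg m r → BigArg m q → evalN σ r ≡ evalN σ q → r ≡ q
bigArg-evalN-injective {σ} {m} m≢0 pm≢0 = injective
  where
  0<p : 0 < pred (σ m)
  0<p = n≢0⇒n>0 pm≢0
  p<m : pred (σ m) < σ m
  p<m = ≤-reflexive (suc-pred (σ m) {{≢-nonZero m≢0}})
  m<s : σ m < suc (σ m)
  m<s = n<1+n (σ m)

  injective : ∀ {r q} → BigArg m r → BigArg m q → evalN σ r ≡ evalN σ q → r ≡ q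
  injective big-0 big-0 _ = refl
  injective big-p big-p _ = refl
  injective big-m big-m _ = refl
  injective big-s big-s _ = refl
  injective big-0 big-p e = contradiction e (<⇒≢ 0<p)
  injective big-0 big-m e = contradiction e (<⇒≢ (<-trans 0<p p<m))
  injective big-0 big-s ()
  injective big-p big-m e = contradiction e (<⇒≢ p<m)
  injective big-p big-s e = contradiction e (<⇒≢ (<-trans p<m m<s))
  injective big-m big-s e = contradiction e (<⇒≢ m<s)
  injective big-p big-0 e = contradiction e (>⇒≢ 0<p)
  injective big-m big-0 e = contradiction e (>⇒≢ (<-trans 0<p p<m))
  injective big-s big-0 ()
  injective big-m big-p e = contradiction e (>⇒≢ p<m)
  injective big-s big-p e = contradiction e (>⇒≢ (<-trans p<m m<s))
  injective big-s big-m e = contradiction e (>⇒≢ m<s)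

module Composition (sig : Sig) where
  open Sig sig
  open Syntax sig
  open import Data.List.Membership.DecPropositional _≟F_ using (_∈?_; _∉?_)

  mutual
    ⟪⟫-cong : ∀ {V W} (t : Tm V) {f g : V → Tm W} → (∀ x → f x ≡ g x) → t ⟪ f ⟫ ≡ t ⟪ g ⟫
    ⟪⟫-cong (var x)    f≗g = f≗g x
    ⟪⟫-cong (con c)    f≗g = refl
    ⟪⟫-cong (fun h ts) f≗g = cong (fun h) (substs-cong ts f≗g)

    substs-cong : ∀ {V W n} (ts : Vec (Tm V) n) {f g : V → Tm W} →
                  (∀ x → f x ≡ g x) → substs ts f ≡ substs ts g
    substs-cong []       f≗g = refl
    substs-cong (t ∷ ts) f≗g = cong₂ _∷_ (⟪⟫-cong t f≗g) (substs-cong ts f≗g)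

  mutual
    ⟪⟫-⟪⟫ : ∀ {U V W} (t : Tm U) (f : U → Tm V) (g : V → Tm W) →
            t ⟪ f ⟫ ⟪ g ⟫ ≡ t ⟪ (λ x → f x ⟪ g ⟫) ⟫
    ⟪⟫-⟪⟫ (var x)    f g = refl
    ⟪⟫-⟪⟫ (con c)    f g = refl
    ⟪⟫-⟪⟫ (fun h ts) f g = cong (fun h) (substs-substs ts f g)

    substs-substs : ∀ {U V W n} (ts : Vec (Tm U) n) (f : U → Tm V) (g : V → Tm W) →
                    substs (substs ts f) g ≡ substs ts (λ x → f x ⟪ g ⟫)
    substs-substs []       f g = refl
    substs-substs (t ∷ ts) f g = cong₂ _∷_ (⟪⟫-⟪⟫ t f g) (substs-substs ts f g)

  lookup-substs : ∀ {V W n} (ts : Vec (Tm V) n) (g : V → Tm W) (i : Fin n) →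
                  lookup (substs ts g) i ≡ lookup ts i ⟪ g ⟫
  lookup-substs (t ∷ ts) g Fin.zero    = refl
  lookup-substs (t ∷ ts) g (Fin.suc i) = lookup-substs ts g i

  dom : FOSub → List FVar
  dom = map proj₁

  composeList : FOSub → FOSub → FOSub
  composeList θ₁ θ₂ = map (map₂ (applyFO θ₂)) θ₁ ++ filter (λ b → proj₁ b ∉? dom θ₁) θ₂

  lookupFO-map₂-++ : ∀ (f : FOTerm → FOTerm) θ ρ x →
                     (x ∉ dom θ → lookupFO ρ x ≡ f (var x)) →
                     lookupFO (map (map₂ f) θ ++ ρ) x ≡ f (lookupFO θ x)
  lookupFO-map₂-++ f []            ρ x outside = outside λ ()
  lookupFO-map₂-++ f ((y , t) ∷ θ) ρ x outside with y ≟F x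
  ... | yes _   = refl
  ... | no y≢x  = lookupFO-map₂-++ f θ ρ x λ x∉θ →
                    outside λ { (here x≡y) → y≢x (sym x≡y) ; (there x∈θ) → x∉θ x∈θ }

  lookupFO-filter-∉ : ∀ {D x} → x ∉ D → ∀ θ →
                      lookupFO (filter (λ b → proj₁ b ∉? D) θ) x ≡ lookupFO θ x
  lookupFO-filter-∉ x∉D [] = refl
  lookupFO-filter-∉ {D} {x} x∉D ((y , t) ∷ θ) with y ∈? D
  ... | no _ with y ≟F x
  ...   | yes _ = refl
  ...   | no _  = lookupFO-filter-∉ x∉D θ
  lookupFO-filter-∉ {D} {x} x∉D ((y , t) ∷ θ) | yes y∈D with y ≟F x
  ...   | yes refl = contradiction y∈D x∉D
  ...   | no _     = lookupFO-filter-∉ x∉D θ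

  lookupFO-composeList : ∀ θ₁ θ₂ x → lookupFO (composeList θ₁ θ₂) x ≡ composeFO θ₁ θ₂ x
  lookupFO-composeList θ₁ θ₂ x =
    lookupFO-map₂-++ (applyFO θ₂) θ₁ _ x (λ x∉θ₁ → lookupFO-filter-∉ x∉θ₁ θ₂)

  dom-composeList : ∀ θ₁ θ₂ → dom (composeList θ₁ θ₂) ≡ dom θ₁ ++ filter (_∉? dom θ₁) (dom θ₂)
  dom-composeList θ₁ θ₂ = begin
    dom (map (map₂ (applyFO θ₂)) θ₁ ++ filter (λ b → proj₁ b ∉? dom θ₁) θ₂)
      ≡⟨ map-++ proj₁ (map (map₂ (applyFO θ₂)) θ₁) _ ⟩
    dom (map (map₂ (applyFO θ₂)) θ₁) ++ dom (filter (λ b → proj₁ b ∉? dom θ₁) θ₂)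
      ≡⟨ cong₂ _++_ (sym (map-∘ θ₁))
                    (map-filter-local proj₁ (λ b → proj₁ b ∉? dom θ₁) (_∉? dom θ₁)
                                      (All.tabulate {xs = θ₂} λ _ → id , id)) ⟩
    dom θ₁ ++ filter (_∉? dom θ₁) (dom θ₂) ∎
    where open ≡-Reasoning

  composeList-unique : ∀ {θ₁ θ₂} → Unique (dom θ₁) → Unique (dom θ₂) →
                       Unique (dom (composeList θ₁ θ₂))
  composeList-unique {θ₁} {θ₂} u₁ u₂ =
    subst Unique (sym (dom-composeList θ₁ θ₂))
      (Unique.++⁺ u₁ (Unique.filter⁺ (_∉? dom θ₁) u₂) disjoint)
    where
    disjoint : Disjoint (dom θ₁) (filter (_∉? dom θ₁) (dom θ₂))
    disjoint (x∈θ₁ , x∈rest) = proj₂ (∈-filter⁻ (_∉? dom θ₁) {xs = dom θ₂} x∈rest) x∈θ₁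

  evalSub-unique : ∀ σ {Θ} → AllPairs (λ a b → ¬ ParUnif (proj₁ a) (proj₁ b)) Θ →
                   Unique (dom (evalSub σ Θ))
  evalSub-unique σ apart =
    AllPairs.map⁺ (AllPairs.map⁺ (AllPairs.map (λ ¬unif eq → ¬unif (σ , eq)) apart))

  SatMaybe : Assignment → ℕ → Maybe Case → Set
  SatMaybe σ m nothing  = ⊤
  SatMaybe σ m (just c) = SatCase σ m c

  sat-lookupCase : ∀ {σ st} → Sat σ st → ∀ m → SatMaybe σ m (lookupCase st m)
  sat-lookupCase []                    m = _
  sat-lookupCase {st = (k , c) ∷ st} (sat-c ∷ sat) m with does (k ≟ m) | proof (k ≟ m)
  ... | true  | ofʸ refl = sat-c
  ... | false | _        = sat-lookupCase sat m

  evalN-psiN : ∀ {σ m} mc → SatMaybe σ m mc → ∀ r → evalN σ (psiN mc m r) ≡ evalN σ r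
  evalN-psiN nothing       _ r = refl
  evalN-psiN (just isBig)  _ r = refl
  evalN-psiN {σ} {m} (just isZero) m≡0 r
    with r ≟N par m | r ≟N np (par m) | r ≟N nz | r ≟N ns (par m)
  ... | yes refl | _        | _        | _        = sym m≡0
  ... | no _     | yes refl | _        | _        = cong pred (sym m≡0)
  ... | no _     | no _     | yes refl | _        = refl
  ... | no _     | no _     | no _     | yes refl = cong suc (sym m≡0)
  ... | no _     | no _     | no _     | no _     = refl
  evalN-psiN {σ} {m} (just isOne) (m≢0 , pm≡0) r
    with r ≟N np (par m) | r ≟N par m | r ≟N ns (par m)
  ... | yes refl | _        | _        = sym pm≡0
  ... | no _     | yes refl | _        = sym (pred≡0⇒≡1 m≢0 pm≡0)
  ... | no _     | no _     | yes refl = cong suc (sym (pred≡0⇒≡1 m≢0 pm≡0))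
  ... | no _     | no _     | no _     = refl

  module _ {st : State} {σ : Assignment} (sat : Sat σ st) where

    evalNs-psiNs : ∀ {k} (ms : Vec ℕ k) rs →
                   vmap (evalN σ) (zipWith (λ m r → psiN (lookupCase st m) m r) ms rs)
                   ≡ vmap (evalN σ) rs
    evalNs-psiNs []       []       = refl
    evalNs-psiNs (m ∷ ms) (r ∷ rs) =
      cong₂ _∷_ (evalN-psiN (lookupCase st m) (sat-lookupCase sat m) r) (evalNs-psiNs ms rs)

    evalVE-psiVE : ∀ A → evalVE σ (psiVE st A) ≡ evalVE σ A
    evalVE-psiVE (X , rs) = cong (cls X) (evalNs-psiNs (parList X) rs)

    mutual
      evalT-psiT : ∀ t → evalT σ (psiT st t) ≡ evalT σ t
      evalT-psiT (scon c)       = refl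
      evalT-psiT (svar x)       = refl
      evalT-psiT (svx X rs)     = cong var (evalVE-psiVE (X , rs))
      evalT-psiT (sfun f ts)    = cong (fun f) (evalTs-psiTs ts)
      evalT-psiT (ssch h ts rs) =
        cong (λ us → unfold h (vmap (evalN σ) rs) ⟪ lookup us ⟫) (evalTs-psiTs ts)

      evalTs-psiTs : ∀ {n} (ts : Vec STerm n) → evalTs σ (psiTs st ts) ≡ evalTs σ ts
      evalTs-psiTs []       = refl
      evalTs-psiTs (t ∷ ts) = cong₂ _∷_ (evalT-psiT t) (evalTs-psiTs ts)

    evalSub-psiSub : ∀ Θ → evalSub σ (psiSub st Θ) ≡ evalSub σ Θ
    evalSub-psiSub []            = refl
    evalSub-psiSub ((A , t) ∷ Θ) =
      cong₂ _∷_ (cong₂ _,_ (evalVE-psiVE A) (evalT-psiT t)) (evalSub-psiSub Θ)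

  -- The arguments ψ_p leaves at a position with list parameter m, indexed by the case of m in the
  -- state; nothing (m not in the state) only arises for the argument 0̄.
  Reduced : ℕ → Maybe Case → NTerm → Set
  Reduced m (just isBig) = BigArg m
  Reduced m _            = Numeral

  reduced-evalN-injective : ∀ {σ m r q} mc → SatMaybe σ m mc →
                            Reduced m mc r → Reduced m mc q → evalN σ r ≡ evalN σ q → r ≡ q
  reduced-evalN-injective nothing       _             = numeral-evalN-injective
  reduced-evalN-injective (just isZero) _             = numeral-evalN-injective
  reduced-evalN-injective (just isOne)  _             = numeral-evalN-injective
  reduced-evalN-injective (just isBig)  (m≢0 , pm≢0) = bigArg-evalN-injective m≢0 pm≢0

  psiN-reduced : ∀ {m r} c → StdN m r → Reduced m (just c) (psiN (just c) m r)
  psiN-reduced {m} isZero std-par = numeral-if-≟N-refl (par m) 0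
  psiN-reduced     isZero std-z   = numeral 0
  psiN-reduced {m} isZero std-p   = numeral-if-≟N-refl (np (par m)) 0
  psiN-reduced {m} isZero std-s   = numeral-if-≟N-refl (ns (par m)) 1
  psiN-reduced {m} isOne  std-par = numeral-if-≟N-refl (par m) 1
  psiN-reduced     isOne  std-z   = numeral 0
  psiN-reduced {m} isOne  std-p   = numeral-if-≟N-refl (np (par m)) 0
  psiN-reduced {m} isOne  std-s   = numeral-if-≟N-refl (ns (par m)) 2
  psiN-reduced     isBig  std-par = big-m
  psiN-reduced     isBig  std-z   = big-0
  psiN-reduced     isBig  std-p   = big-p
  psiN-reduced     isBig  std-s   = big-s

  std-numeral : ∀ {m r} → StdN m r → m ∉ paramsN r → Numeral r
  std-numeral std-z   _   = numeral 0
  std-numeral std-par m∉r = contradiction (here refl) m∉r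
  std-numeral std-p   m∉r = contradiction (here refl) m∉r
  std-numeral std-s   m∉r = contradiction (here refl) m∉r

  lookupCase-∈ : ∀ {st m} → m ∈ map proj₁ st → lookupCase st m ≢ nothing
  lookupCase-∈ {(k , c) ∷ st} {m} m∈ with does (k ≟ m) | proof (k ≟ m)
  ... | true  | _ = λ ()
  ... | false | ofⁿ k≢m with m∈
  ...   | here m≡k   = contradiction (sym m≡k) k≢m
  ...   | there m∈st = lookupCase-∈ m∈st

  ReducedVE : State → VE → Set
  ReducedVE st (X , rs) = Pointwise (λ m → Reduced m (lookupCase st m)) (parList X) rs

  data AllVE (Q : VE → Set) : STerm → Set where
    scon : ∀ c → AllVE Q (scon c)
    svar : ∀ x → AllVE Q (svar x)
    svx  : ∀ {X rs} → Q (X , rs) → AllVE Q (svx X rs)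
    sfun : ∀ {f ts} → VAll.All (AllVE Q) ts → AllVE Q (sfun f ts)
    ssch : ∀ {h ts} rs → VAll.All (AllVE Q) ts → AllVE Q (ssch h ts rs)

  ReducedKeys : State → SSub → Set
  ReducedKeys st = All (ReducedVE st ∘ proj₁)

  ReducedBinding : State → VE × STerm → Set
  ReducedBinding st (A , t) = ReducedVE st A × AllVE (ReducedVE st) t

  module _ {P : List ℕ} {st : State} (over : IsStateOver P st) where

    psiN-lookupCase-reduced : ∀ {m r} → StdN m r → All (_∈ P) (paramsN r) →
                      Reduced m (lookupCase st m) (psiN (lookupCase st m) m r)
    psiN-lookupCase-reduced {m} s params∈P with lookupCase st m in eq
    ... | just c  = psiN-reduced c s
    ... | nothing = std-numeral s λ m∈r →
          lookupCase-∈ (subst (m ∈_) (sym over) (All.lookup params∈P m∈r)) eq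

    psiNs-reduced : ∀ {k} (ms : Vec ℕ k) {rs} → Pointwise StdN ms rs →
                    All (_∈ P) (concatMap paramsN (toList rs)) →
                    Pointwise (λ m → Reduced m (lookupCase st m))
                              ms (zipWith (λ m r → psiN (lookupCase st m) m r) ms rs)
    psiNs-reduced []       []                        _        = []
    psiNs-reduced (m ∷ ms) {r ∷ rs} (s ∷ ss) params∈P =
      psiN-lookupCase-reduced s (++⁻ˡ (paramsN r) params∈P)
      ∷ psiNs-reduced ms ss (++⁻ʳ (paramsN r) params∈P)

    psiVE-reduced : ∀ {A} → StdVE A → All (_∈ P) (paramsVE A) → ReducedVE st (psiVE st A)
    psiVE-reduced {X , rs} = psiNs-reduced (parList X)

    mutual
      psiT-reduced : ∀ {t} → StdT t → All (_∈ P) (paramsT t) → AllVE (ReducedVE st) (psiT st t)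
      psiT-reduced (std-con c)         _        = scon c
      psiT-reduced (std-var x)         _        = svar x
      psiT-reduced (std-vx X rs s)     params∈P = svx (psiVE-reduced {X , rs} s params∈P)
      psiT-reduced (std-fun f ts s)    params∈P = sfun (psiTs-reduced s params∈P)
      psiT-reduced (std-sch h ts rs s) params∈P =
        ssch rs (psiTs-reduced s (++⁻ˡ (paramsTs ts) params∈P))

      psiTs-reduced : ∀ {n} {ts : Vec STerm n} → VAll.All StdT ts → All (_∈ P) (paramsTs ts) →
                      VAll.All (AllVE (ReducedVE st)) (psiTs st ts)
      psiTs-reduced VAll.[]                  _        = VAll.[]
      psiTs-reduced {ts = t ∷ _} (s VAll.∷ ss) params∈P =
        psiT-reduced s (++⁻ˡ (paramsT t) params∈P)
        VAll.∷ psiTs-reduced ss (++⁻ʳ (paramsT t) params∈P)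

    psiSub-reduced : ∀ {Θ} → All (λ b → StdVE (proj₁ b) × StdT (proj₂ b)) Θ →
                     All (_∈ P) (paramsSub Θ) → All (ReducedBinding st) (psiSub st Θ)
    psiSub-reduced []                             _        = []
    psiSub-reduced {(A , t) ∷ _} ((stdA , stdt) ∷ stds) params∈P =
      (psiVE-reduced stdA (++⁻ˡ (paramsVE A) here∈P) , psiT-reduced stdt (++⁻ʳ (paramsVE A) here∈P))
      ∷ psiSub-reduced stds (++⁻ʳ (paramsVE A ++ paramsT t) params∈P)
      where here∈P = ++⁻ˡ (paramsVE A ++ paramsT t) params∈P

  cls-injective : ∀ {X Y v w} → cls X v ≡ cls Y w → Σ (X ≡ Y) λ { refl → v ≡ w }
  cls-injective refl = refl , refl

  lookupFO-evalSub-ord : ∀ σ Δ x → lookupFO (evalSub σ Δ) (ord x) ≡ var (ord x)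
  lookupFO-evalSub-ord σ []      x = refl
  lookupFO-evalSub-ord σ (_ ∷ Δ) x = lookupFO-evalSub-ord σ Δ x

  evalVE-∈-dom⁺ : ∀ σ {B Δ} → Any (λ a → proj₁ a ≡ B) Δ → evalVE σ B ∈ dom (evalSub σ Δ)
  evalVE-∈-dom⁺ σ (here refl) = here refl
  evalVE-∈-dom⁺ σ (there b∈Δ) = there (evalVE-∈-dom⁺ σ b∈Δ)

  module _ {st : State} {σ : Assignment} (sat : Sat σ st) where

    evalNs-injective : ∀ {k} (ms : Vec ℕ k) {rs qs : Vec NTerm k} →
                       Pointwise (λ m → Reduced m (lookupCase st m)) ms rs →
                       Pointwise (λ m → Reduced m (lookupCase st m)) ms qs →
                       vmap (evalN σ) rs ≡ vmap (evalN σ) qs → rs ≡ qs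
    evalNs-injective []       []       []       _  = refl
    evalNs-injective (m ∷ ms) (r ∷ rs) (q ∷ qs) eq with ∷-injective eq
    ... | head-eq , tail-eq =
      cong₂ _∷_ (reduced-evalN-injective (lookupCase st m) (sat-lookupCase sat m) r q head-eq)
                (evalNs-injective ms rs qs tail-eq)

    evalVE-injective : ∀ {A B} → ReducedVE st A → ReducedVE st B → evalVE σ A ≡ evalVE σ B → A ≡ B
    evalVE-injective {X , _} rA rB eq with cls-injective eq
    ... | refl , args-eq = cong (X ,_) (evalNs-injective (parList X) rA rB args-eq)

    lookupFO-evalSub-evalVE : ∀ {A Δ} → ReducedVE st A → ReducedKeys st Δ →
                              lookupFO (evalSub σ Δ) (evalVE σ A)
                              ≡ maybe (evalT σ) (var (evalVE σ A)) (lookupVE Δ A)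
    lookupFO-evalSub-evalVE rA [] = refl
    lookupFO-evalSub-evalVE {A} {(B , u) ∷ Δ} rA (rB ∷ rΔ) with B ≟VE A | evalVE σ B ≟F evalVE σ A
    ... | yes refl | yes _   = refl
    ... | yes refl | no B≢B  = contradiction refl B≢B
    ... | no B≢A   | yes eq  = contradiction (evalVE-injective rB rA eq) B≢A
    ... | no _     | no _    = lookupFO-evalSub-evalVE rA rΔ

    mutual
      evalT-applyS : ∀ {t Δ} → AllVE (ReducedVE st) t → ReducedKeys st Δ →
                     evalT σ (applyS t Δ) ≡ applyFO (evalSub σ Δ) (evalT σ t)
      evalT-applyS (scon c) rΔ = refl
      evalT-applyS {Δ = Δ} (svar x) rΔ = sym (lookupFO-evalSub-ord σ Δ x)
      evalT-applyS {svx X rs} {Δ} (svx rA) rΔ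
        with lookupVE Δ (X , rs) | lookupFO-evalSub-evalVE {X , rs} rA rΔ
      ... | just u  | eq = sym eq
      ... | nothing | eq = sym eq
      evalT-applyS (sfun rts) rΔ = cong (fun _) (evalTs-applySs rts rΔ)
      evalT-applyS {ssch h ts rs} {Δ} (ssch _ rts) rΔ = begin
        body ⟪ lookup (evalTs σ (applySs ts Δ)) ⟫
          ≡⟨ ⟪⟫-cong body (λ i → trans (cong (λ us → lookup us i) (evalTs-applySs rts rΔ))
                                       (lookup-substs (evalTs σ ts) θ i)) ⟩
        body ⟪ (λ i → lookup (evalTs σ ts) i ⟪ θ ⟫) ⟫
          ≡⟨ sym (⟪⟫-⟪⟫ body (lookup (evalTs σ ts)) θ) ⟩
        body ⟪ lookup (evalTs σ ts) ⟫ ⟪ θ ⟫ ∎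
        where
        open ≡-Reasoning
        body = unfold h (vmap (evalN σ) rs)
        θ    = lookupFO (evalSub σ Δ)

      evalTs-applySs : ∀ {n} {ts : Vec STerm n} {Δ} →
                       VAll.All (AllVE (ReducedVE st)) ts → ReducedKeys st Δ →
                       evalTs σ (applySs ts Δ) ≡ substs (evalTs σ ts) (lookupFO (evalSub σ Δ))
      evalTs-applySs VAll.[]           rΔ = refl
      evalTs-applySs (rt VAll.∷ rts) rΔ = cong₂ _∷_ (evalT-applyS rt rΔ) (evalTs-applySs rts rΔ)

    evalVE-∈-dom⁻ : ∀ {B Δ} → ReducedVE st B → ReducedKeys st Δ →
                   evalVE σ B ∈ dom (evalSub σ Δ) → Any (λ a → proj₁ a ≡ B) Δ
    evalVE-∈-dom⁻ rB (rA ∷ _)  (here eq)    = here (evalVE-injective rA rB (sym eq))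
    evalVE-∈-dom⁻ rB (_  ∷ rΔ) (there b∈Δ) = there (evalVE-∈-dom⁻ rB rΔ b∈Δ)

    evalSub-composeS : ∀ {Δ₁ Δ₂} → All (ReducedBinding st) Δ₁ → ReducedKeys st Δ₂ →
                       evalSub σ (composeS Δ₁ Δ₂) ≡ composeList (evalSub σ Δ₁) (evalSub σ Δ₂)
    evalSub-composeS {Δ₁} {Δ₂} r₁ r₂ = begin
      evalSub σ (map apply₂ Δ₁ ++ filter unbound? Δ₂)
        ≡⟨ map-++ _ (map apply₂ Δ₁) _ ⟩
      evalSub σ (map apply₂ Δ₁) ++ evalSub σ (filter unbound? Δ₂)
        ≡⟨ cong₂ _++_ (evalSub-apply₂ r₁)
                      (map-filter-local evalBinding unbound? (λ b → proj₁ b ∉? dom (evalSub σ Δ₁))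
                                        (All.map (λ {b} → unbound⇔ {b}) r₂)) ⟩
      composeList (evalSub σ Δ₁) (evalSub σ Δ₂) ∎
      where
      open ≡-Reasoning
      apply₂ : VE × STerm → VE × STerm
      apply₂ (A , t) = A , applyS t Δ₂

      evalBinding : VE × STerm → FVar × FOTerm
      evalBinding (A , t) = evalVE σ A , evalT σ t

      unbound? : Decidable (λ b → ¬ Any (λ a → proj₁ a ≡ proj₁ b) Δ₁)
      unbound? b = ¬? (any? (λ a → proj₁ a ≟VE proj₁ b) Δ₁)

      evalSub-apply₂ : ∀ {Δ} → All (ReducedBinding st) Δ →
                       evalSub σ (map apply₂ Δ) ≡ map (map₂ (applyFO (evalSub σ Δ₂))) (evalSub σ Δ)
      evalSub-apply₂ []              = refl
      evalSub-apply₂ ((_ , rt) ∷ rΔ) =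
        cong₂ _∷_ (cong (_ ,_) (evalT-applyS rt r₂)) (evalSub-apply₂ rΔ)

      unbound⇔ : ∀ {b} → ReducedVE st (proj₁ b) →
                 (¬ Any (λ a → proj₁ a ≡ proj₁ b) Δ₁ → evalVE σ (proj₁ b) ∉ dom (evalSub σ Δ₁))
                 × (evalVE σ (proj₁ b) ∉ dom (evalSub σ Δ₁) → ¬ Any (λ a → proj₁ a ≡ proj₁ b) Δ₁)
      unbound⇔ rB = (λ unbound b∈ → unbound (evalVE-∈-dom⁻ rB (All.map proj₁ r₁) b∈))
                  , (λ b∉ b∈Δ₁ → b∉ (evalVE-∈-dom⁺ σ b∈Δ₁))

theorem2 : (sig : Sig) → let open Syntax sig in
    (Θ₁ Θ₂ : SSub) → IsStdSSub Θ₁ → IsStdSSub Θ₂ →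
    (P : List ℕ) → All (_∈ P) (paramsSub Θ₁) → All (_∈ P) (paramsSub Θ₂) →
    (st : State) → IsStateOver P st →
    (σ : Assignment) → Sat σ st →
    AllPairs _≢_ (map proj₁ (evalSub σ (restrict st Θ₁ Θ₂)))
    × (∀ x → lookupFO (evalSub σ (restrict st Θ₁ Θ₂)) x
             ≡ composeFO (evalSub σ Θ₁) (evalSub σ Θ₂) x)
theorem2 sig Θ₁ Θ₂ (std₁ , apart₁) (std₂ , apart₂) P params₁ params₂ st over σ sat =
  subst (Unique ∘ dom) (sym restrict≡composeList)
        (composeList-unique (evalSub-unique σ apart₁) (evalSub-unique σ apart₂))
  , λ x → trans (cong (λ θ → lookupFO θ x) restrict≡composeList)
                (lookupFO-composeList (evalSub σ Θ₁) (evalSub σ Θ₂) x)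
  where
  open Syntax sig
  open Composition sig
  open ≡-Reasoning

  restrict≡composeList : evalSub σ (restrict st Θ₁ Θ₂) ≡ composeList (evalSub σ Θ₁) (evalSub σ Θ₂)
  restrict≡composeList = begin
    evalSub σ (composeS (psiSub st Θ₁) (psiSub st Θ₂))
      ≡⟨ evalSub-composeS sat (psiSub-reduced over std₁ params₁)
                              (All.map proj₁ (psiSub-reduced over std₂ params₂)) ⟩
    composeList (evalSub σ (psiSub st Θ₁)) (evalSub σ (psiSub st Θ₂))
      ≡⟨ cong₂ composeList (evalSub-psiSub sat Θ₁) (evalSub-psiSub sat Θ₂) ⟩
    composeList (evalSub σ Θ₁) (evalSub σ Θ₂) ∎
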